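{- Let $\mu$ be a partition and $k$ a positive integer. If a nested sequence of $k$ $L$'s in $\mu$ has weight $w_k(\mu)$, then the corner of each $L$ in the sequence lies in a salient row of $\mu$.
   Context: Partitions are identified with Ferrers boards; box $(i,j)$ is in row $i$ from the top and column $j$ from the left. An $L$ in $\mu$ is a set of boxes obtained by choosing a box $(i,j)$ of $\mu$ (its corner) and taking all boxes $(i,x)$ of $\mu$ with $x\ge j$ together with all boxes $(y,j)$ with $y\le i$. A nested sequence of $L$'s in $\mu$ is a sequence $L_1,\dots,L_k$ of $L$'s such that for $1\le c<d\le k$ the corner of $L_d$ is strictly above and strictly to the right of the corner of $L_c$; its weight is the total number of boxes in all the $L$'s. $w_k(\mu)$ is the maximum weight of a nested sequence of $k$ $L$'s in $\mu$. Row $i$ of $\mu$ is salient if there exists $j>i$ with $i+\mu_i\ge j+\mu_j$. -}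

module Defs where

open import Data.Nat using (ℕ; zero; suc; _+_; _≤_; _<_; _≟_; _≤?_)
open import Data.List using (List; []; _∷_; length; filter; concatMap; map)
open import Data.Nat.ListAction using (sum)
open import Data.List.Relation.Unary.All using (All)
open import Data.List.Relation.Unary.AllPairs using (AllPairs)
open import Data.Product using (_×_; _,_; proj₁; proj₂; ∃-syntax)
open import Data.Sum using (_⊎_)
open import Relation.Binary.PropositionalEquality using (_≡_)
open import Relation.Nullary.Decidable using (Dec; _×-dec_; _⊎-dec_)

-- A partition is a list of its (positive) parts μ₁ ≥ μ₂ ≥ … .
-- Rows and columns are 1-based.  μ_i = 0 for i = 0 or i > length μ.
part : List ℕ → ℕ → ℕ
part []       _             = 0
part (x ∷ xs) zero          = 0
part (x ∷ xs) (suc zero)    = x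
part (x ∷ xs) (suc (suc i)) = part xs (suc i)

IsPartition : List ℕ → Set
IsPartition μ = All (λ x → 1 ≤ x) μ × (∀ i → 1 ≤ i → part μ (suc i) ≤ part μ i)

-- A box (i , j) : row i, column j.
Box : Set
Box = ℕ × ℕ

InBoard : List ℕ → Box → Set
InBoard μ (i , j) = 1 ≤ i × 1 ≤ j × j ≤ part μ i

range : ℕ → ℕ → List ℕ
range a zero    = []
range a (suc n) = a ∷ range (suc a) n

boxes : List ℕ → List Box
boxes μ = concatMap (λ i → map (λ j → (i , j)) (range 1 (part μ i))) (range 1 (length μ))

InL : Box → Box → Set
InL (i , j) (a , b) = (a ≡ i × j ≤ b) ⊎ (b ≡ j × a ≤ i)

inL? : (c b : Box) → Dec (InL c b)
inL? (i , j) (a , b) = ((a ≟ i) ×-dec (j ≤? b)) ⊎-dec ((b ≟ j) ×-dec (a ≤? i))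

Lboxes : List ℕ → Box → List Box
Lboxes μ c = filter (inL? c) (boxes μ)

Lsize : List ℕ → Box → ℕ
Lsize μ c = length (Lboxes μ c)

-- A nested sequence of L's is given by the list of corners L₁, …, L_k.
-- For c < d: corner of L_d strictly above and strictly right of corner of L_c.
StrictlyNE : Box → Box → Set
StrictlyNE (ic , jc) (id , jd) = id < ic × jc < jd

NestedSeq : List ℕ → ℕ → List Box → Set
NestedSeq μ k S = length S ≡ k × All (InBoard μ) S × AllPairs StrictlyNE S

weight : List ℕ → List Box → ℕ
weight μ S = sum (map (Lsize μ) S)

IsWk : List ℕ → ℕ → ℕ → Set
IsWk μ k w = (∃[ S ] (NestedSeq μ k S × weight μ S ≡ w))
           × (∀ T → NestedSeq μ k T → weight μ T ≤ w)

Salient : List ℕ → ℕ → Set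
Salient μ i = ∃[ j ] (i < j × j + part μ j ≤ i + part μ i)

module Submission where

-- Write reach(r) = r + μ_r for the "reach" of row r.  An L with corner
-- (r , c) consists of the r - 1 boxes above its corner and the μ_r - c + 1
-- boxes of its arm, so
--     |L(r , c)| + c = reach(r).                               (Lsize+column)
-- Row i fails to be salient exactly when reach(j) > reach(i) for every
-- j > i; a bounded search decides which case holds.
-- Now let row i be non-salient and let a nested sequence have a corner
-- (i , c₀).  Let (i , c₀), (i+1 , c₁), …, (i+m , c_m) be the maximal run of
-- corners of the sequence in consecutive rows starting there.  Moving each
-- corner of the run one row down keeps the sequence nested; the new corners
-- are boxes of μ because c_t + (i+t) ≤ c₀ + i ≤ reach(i) < reach(i+t+1);
-- and by the size formula the weight grows by reach(i+m+1) - reach(i) > 0.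
-- Hence a sequence of maximal weight has all its corners in salient rows.

open import Defs
open import Data.Nat
open import Data.Nat.Properties
open import Data.Nat.ListAction using (sum)
open import Data.List using (List; []; _∷_; _++_; length; filter; concatMap; map)
open import Data.List.Properties using (filter-accept; filter-reject; filter-++; length-++)
open import Data.List.Relation.Unary.All using (All; _∷_; tabulate)
import Data.List.Relation.Unary.All as All
open import Data.List.Relation.Unary.Any using (Any; here; there)
import Data.List.Relation.Unary.Any as Any
open import Data.List.Membership.Propositional using (_∈_)
open import Data.List.Relation.Unary.AllPairs using (AllPairs; _∷_)
open import Data.Product using (_×_; _,_; proj₁; proj₂; ∃-syntax)
open import Data.Sum using (_⊎_; inj₁; inj₂)
open import Function using (_∘_)
open import Relation.Nullary using (¬_; yes; no; contradiction)
open import Relation.Nullary.Decidable using (_×-dec_)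
open import Relation.Unary using (Decidable)
open import Relation.Binary.PropositionalEquality
open import Algebra.Properties.CommutativeSemigroup +-commutativeSemigroup
  using (x∙yz≈y∙xz; x∙yz≈xz∙y; xy∙z≈xz∙y)

reach : List ℕ → ℕ → ℕ
reach μ r = r + part μ r

part-antitone : ∀ {μ} → IsPartition μ → ∀ {y r} → 1 ≤ y → y ≤ r → part μ r ≤ part μ y
part-antitone {μ} P {y} 1≤y y≤r = go (≤⇒≤′ y≤r)
  where
    go : ∀ {r} → y ≤′ r → part μ r ≤ part μ y
    go ≤′-refl = ≤-refl
    go (≤′-step {r} y≤′r) = ≤-trans (proj₂ P r (≤-trans 1≤y (≤′⇒≤ y≤′r))) (go y≤′r)

nonempty-row-bound : ∀ μ r → 1 ≤ part μ r → r ≤ length μ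
nonempty-row-bound []      r             ()
nonempty-row-bound (x ∷ μ) zero          _  = z≤n
nonempty-row-bound (x ∷ μ) (suc zero)    _  = s≤s z≤n
nonempty-row-bound (x ∷ μ) (suc (suc r)) h  = s≤s (nonempty-row-bound μ (suc r) h)

length-filter-concatMap : ∀ {A B : Set} {P : A → Set} (P? : Decidable P) (g : B → List A) xs →
  length (filter P? (concatMap g xs)) ≡ sum (map (length ∘ filter P? ∘ g) xs)
length-filter-concatMap P? g [] = refl
length-filter-concatMap P? g (x ∷ xs) = begin
  length (filter P? (g x ++ concatMap g xs))
    ≡⟨ cong length (filter-++ P? (g x) (concatMap g xs)) ⟩
  length (filter P? (g x) ++ filter P? (concatMap g xs))
    ≡⟨ length-++ (filter P? (g x)) ⟩
  length (filter P? (g x)) + length (filter P? (concatMap g xs))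
    ≡⟨ cong (length (filter P? (g x)) +_) (length-filter-concatMap P? g xs) ⟩
  length (filter P? (g x)) + sum (map (length ∘ filter P? ∘ g) xs) ∎
  where open ≡-Reasoning

module LCount (r c : ℕ) where

  hits : ℕ → ℕ → ℕ → ℕ
  hits y a n = length (filter (inL? (r , c)) (map (y ,_) (range a n)))

  hit : ∀ {y a n} → InL (r , c) (y , a) → hits y a (suc n) ≡ suc (hits y (suc a) n)
  hit p = cong length (filter-accept (inL? (r , c)) p)

  miss : ∀ {y a n} → ¬ InL (r , c) (y , a) → hits y a (suc n) ≡ hits y (suc a) n
  miss ¬p = cong length (filter-reject (inL? (r , c)) ¬p)

  hits-below : ∀ {y} a n → r < y → hits y a n ≡ 0
  hits-below a zero    r<y = refl
  hits-below a (suc n) r<y = trans (miss outside) (hits-below (suc a) n r<y)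
    where
      outside : ¬ InL (r , c) (_ , a)
      outside (inj₁ (y≡r , _)) = <⇒≢ r<y (sym y≡r)
      outside (inj₂ (_ , y≤r)) = <⇒≱ r<y y≤r

  hits-above-right : ∀ {y} a n → y < r → c < a → hits y a n ≡ 0
  hits-above-right a zero    y<r c<a = refl
  hits-above-right a (suc n) y<r c<a = trans (miss outside) (hits-above-right (suc a) n y<r (m<n⇒m<1+n c<a))
    where
      outside : ¬ InL (r , c) (_ , a)
      outside (inj₁ (y≡r , _)) = <⇒≢ y<r y≡r
      outside (inj₂ (a≡c , _)) = <⇒≢ c<a (sym a≡c)

  hits-above : ∀ {y} a n → y < r → a ≤ c → c < a + n → hits y a n ≡ 1
  hits-above a zero y<r a≤c c<a+0 = contradiction (subst (c <_) (+-identityʳ a) c<a+0) (≤⇒≯ a≤c)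
  hits-above a (suc n) y<r a≤c c<a+1+n with a ≟ c
  ... | yes refl = trans (hit (inj₂ (refl , <⇒≤ y<r))) (cong suc (hits-above-right (suc a) n y<r ≤-refl))
  ... | no a≢c   = trans (miss outside) (hits-above (suc a) n y<r (≤∧≢⇒< a≤c a≢c) (subst (c <_) (+-suc a n) c<a+1+n))
    where
      outside : ¬ InL (r , c) (_ , a)
      outside (inj₁ (y≡r , _)) = <⇒≢ y<r y≡r
      outside (inj₂ (a≡c , _)) = a≢c a≡c

  hits-arm : ∀ a n → c ≤ a → hits r a n ≡ n
  hits-arm a zero    c≤a = refl
  hits-arm a (suc n) c≤a = trans (hit (inj₁ (refl , c≤a))) (cong suc (hits-arm (suc a) n (m≤n⇒m≤1+n c≤a)))

  hits-corner-row : ∀ a n → a ≤ c → c ≤ a + n → hits r a n + c ≡ a + n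
  hits-corner-row a n a≤c c≤a+n with a ≟ c
  ... | yes refl = trans (cong (_+ a) (hits-arm a n ≤-refl)) (+-comm n a)
  hits-corner-row a zero a≤c c≤a+0 | no a≢c =
    contradiction (≤-antisym a≤c (subst (c ≤_) (+-identityʳ a) c≤a+0)) a≢c
  hits-corner-row a (suc n) a≤c c≤a+1+n | no a≢c = begin
    hits r a (suc n) + c    ≡⟨ cong (_+ c) (miss outside) ⟩
    hits r (suc a) n + c    ≡⟨ hits-corner-row (suc a) n (≤∧≢⇒< a≤c a≢c) (subst (c ≤_) (+-suc a n) c≤a+1+n) ⟩
    suc a + n               ≡⟨ +-suc a n ⟨
    a + suc n               ∎
    where
      open ≡-Reasoning
      outside : ¬ InL (r , c) (r , a)
      outside (inj₁ (_ , c≤a)) = <⇒≱ (≤∧≢⇒< a≤c a≢c) c≤a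
      outside (inj₂ (a≡c , _)) = a≢c a≡c

module _ (μ : List ℕ) (r c : ℕ) where
  open LCount r c

  colHits : ℕ → ℕ → ℕ
  colHits a n = sum (map (λ y → hits y 1 (part μ y)) (range a n))

  colHits-below : ∀ a n → r < a → colHits a n ≡ 0
  colHits-below a zero    r<a = refl
  colHits-below a (suc n) r<a =
    cong₂ _+_ (hits-below 1 (part μ a) r<a) (colHits-below (suc a) n (m<n⇒m<1+n r<a))

  -- Rows a, …, r-1 contribute one box each, row r contributes its arm.
  colHits-formula : ∀ a n → a ≤ r → r < a + n → (∀ {y} → a ≤ y → y < r → c ≤ part μ y) →
    1 ≤ c → c ≤ part μ r → a + (colHits a n + c) ≡ suc (reach μ r)
  colHits-formula a zero a≤r r<a+0 _ _ _ = contradiction (subst (r <_) (+-identityʳ a) r<a+0) (≤⇒≯ a≤r)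
  colHits-formula a (suc n) a≤r r<a+1+n long 1≤c c≤μr with m≤n⇒m<n∨m≡n a≤r
  ... | inj₂ refl = begin
    a + ((hits a 1 (part μ a) + colHits (suc a) n) + c)
      ≡⟨ cong (λ z → a + ((hits a 1 (part μ a) + z) + c)) (colHits-below (suc a) n ≤-refl) ⟩
    a + ((hits a 1 (part μ a) + 0) + c)
      ≡⟨ cong (λ z → a + (z + c)) (+-identityʳ _) ⟩
    a + (hits a 1 (part μ a) + c)
      ≡⟨ cong (a +_) (hits-corner-row 1 (part μ a) 1≤c (m≤n⇒m≤1+n c≤μr)) ⟩
    a + suc (part μ a)
      ≡⟨ +-suc a (part μ a) ⟩
    suc (reach μ a) ∎
    where open ≡-Reasoning
  ... | inj₁ a<r = begin
    a + ((hits a 1 (part μ a) + colHits (suc a) n) + c)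
      ≡⟨ cong (λ z → a + ((z + colHits (suc a) n) + c)) (hits-above 1 (part μ a) a<r 1≤c (s≤s (long ≤-refl a<r))) ⟩
    a + suc (colHits (suc a) n + c)
      ≡⟨ +-suc a _ ⟩
    suc a + (colHits (suc a) n + c)
      ≡⟨ colHits-formula (suc a) n a<r (subst (r <_) (+-suc a n) r<a+1+n) (long ∘ <⇒≤) 1≤c c≤μr ⟩
    suc (reach μ r) ∎
    where open ≡-Reasoning

Lsize+column : ∀ {μ} → IsPartition μ → ∀ {r c} → InBoard μ (r , c) → Lsize μ (r , c) + c ≡ reach μ r
Lsize+column {μ} P {r} {c} (1≤r , 1≤c , c≤μr) = suc-injective (begin
  suc (Lsize μ (r , c) + c)
    ≡⟨ cong (λ z → suc (z + c)) (length-filter-concatMap (inL? (r , c)) rowBoxes (range 1 (length μ))) ⟩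
  1 + (colHits μ r c 1 (length μ) + c)
    ≡⟨ colHits-formula μ r c 1 (length μ) 1≤r (s≤s (nonempty-row-bound μ r (≤-trans 1≤c c≤μr)))
         (λ 1≤y y<r → ≤-trans c≤μr (part-antitone P 1≤y (<⇒≤ y<r))) 1≤c c≤μr ⟩
  suc (reach μ r) ∎)
  where
    open ≡-Reasoning
    rowBoxes : ℕ → List Box
    rowBoxes i = map (i ,_) (range 1 (part μ i))

-- Either row i is salient, or the reach strictly increases after row i.
-- A witness j of salience satisfies j ≤ reach(i), so the search is bounded.
salient-or-increasing : ∀ μ i → Salient μ i ⊎ (∀ j → i < j → reach μ i < reach μ j)
salient-or-increasing μ i
  with anyUpTo? (λ j → (i <? j) ×-dec (reach μ j ≤? reach μ i)) (suc (reach μ i))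
... | yes (j , _ , salient) = inj₁ (j , salient)
... | no none = inj₂ λ j i<j → ≰⇒> λ reach-j≤ →
        none (j , s≤s (≤-trans (m≤m+n j (part μ j)) reach-j≤) , i<j , reach-j≤)

Nested : List ℕ → List Box → Set
Nested μ S = All (InBoard μ) S × AllPairs StrictlyNE S

NE-trans : ∀ {a b d} → StrictlyNE a b → StrictlyNE b d → StrictlyNE a d
NE-trans (b<a , a<b) (d<b , b<d) = <-trans d<b b<a , <-trans a<b b<d

NE-trans-all : ∀ {a b} {ds : List Box} → StrictlyNE a b → All (StrictlyNE b) ds → All (StrictlyNE a) ds
NE-trans-all a↗b = All.map (NE-trans a↗b)

NE-lower : ∀ {r r' c} {ds : List Box} → r ≤ r' → All (StrictlyNE (r , c)) ds → All (StrictlyNE (r' , c)) ds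
NE-lower r≤r' = All.map λ (d<r , c<d) → <-≤-trans d<r r≤r' , c<d

+-trade-< : ∀ {x y u v} → x + u ≡ y + v → u < v → y < x
+-trade-< {x} {y} {u} {v} eq u<v = +-cancelʳ-< u y x (begin-strict
  y + u   <⟨ +-monoʳ-< y u<v ⟩
  y + v   ≡⟨ eq ⟨
  x + u   ∎)
  where open ≤-Reasoning

module Shift (μ : List ℕ) (P : IsPartition μ) (i : ℕ)
             (increasing : ∀ j → i < j → reach μ i < reach μ j) where

  Lsize-shift : ∀ {r c} → InBoard μ (r , c) → InBoard μ (suc r , c) →
    Lsize μ (suc r , c) + reach μ r ≡ Lsize μ (r , c) + reach μ (suc r)
  Lsize-shift {r} {c} box box-below = begin
    Lsize μ (suc r , c) + reach μ r              ≡⟨ cong (Lsize μ (suc r , c) +_) (Lsize+column P box) ⟨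
    Lsize μ (suc r , c) + (Lsize μ (r , c) + c)  ≡⟨ x∙yz≈y∙xz (Lsize μ (suc r , c)) (Lsize μ (r , c)) c ⟩
    Lsize μ (r , c) + (Lsize μ (suc r , c) + c)  ≡⟨ cong (Lsize μ (r , c) +_) (Lsize+column P box-below) ⟩
    Lsize μ (r , c) + reach μ (suc r)            ∎
    where open ≡-Reasoning

  -- A corner in a row r ≥ i with c + r ≤ reach(i) can be moved one row
  -- down inside μ, because reach(i) < reach(r+1).
  shift-inBoard : ∀ {r c} → i ≤ r → c + r ≤ reach μ i → 1 ≤ c → InBoard μ (suc r , c)
  shift-inBoard {r} {c} i≤r c+r≤reach 1≤c = s≤s z≤n , 1≤c , +-cancelˡ-≤ r c (part μ (suc r)) r+c≤r+μ
    where
      r+c≤r+μ : r + c ≤ r + part μ (suc r)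
      r+c≤r+μ = subst (_≤ r + part μ (suc r)) (+-comm c r)
                  (≤-pred (≤-<-trans c+r≤reach (increasing (suc r) (s≤s i≤r))))

  weight-shift : ∀ {r c} rest T → InBoard μ (r , c) → InBoard μ (suc r , c) →
    weight μ T + reach μ i ≡ weight μ rest + reach μ r →
    weight μ ((suc r , c) ∷ T) + reach μ i ≡ weight μ ((r , c) ∷ rest) + reach μ (suc r)
  weight-shift {r} {c} rest T box box-below balance = begin
    (L↓ + weight μ T) + reach μ i      ≡⟨ +-assoc L↓ (weight μ T) (reach μ i) ⟩
    L↓ + (weight μ T + reach μ i)      ≡⟨ cong (L↓ +_) balance ⟩
    L↓ + (weight μ rest + reach μ r)   ≡⟨ x∙yz≈xz∙y L↓ (weight μ rest) (reach μ r) ⟩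
    (L↓ + reach μ r) + weight μ rest   ≡⟨ cong (_+ weight μ rest) (Lsize-shift box box-below) ⟩
    (L + reach μ (suc r)) + weight μ rest ≡⟨ xy∙z≈xz∙y L (reach μ (suc r)) (weight μ rest) ⟩
    (L + weight μ rest) + reach μ (suc r) ∎
    where
      open ≡-Reasoning
      L L↓ : ℕ
      L  = Lsize μ (r , c)
      L↓ = Lsize μ (suc r , c)

  -- Once the run reaching down to (r , c) is moved down, the weight has
  -- grown by reach(r+1) - reach(i) > 0.
  shift-improves : ∀ {r c} rest T → InBoard μ (r , c) → InBoard μ (suc r , c) → i ≤ r →
    weight μ T + reach μ i ≡ weight μ rest + reach μ r →
    weight μ ((r , c) ∷ rest) < weight μ ((suc r , c) ∷ T)
  shift-improves rest T box box-below i≤r balance =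
    +-trade-< (weight-shift rest T box box-below balance) (increasing _ (s≤s i≤r))

  -- The state after processing a sequence from its lowest corner h up to
  -- the corner in row i; `rest` are the corners above h.
  -- improved: the corners above h can be replaced by a heavier T.
  -- pending:  h = (r , c) ends the run of consecutive rows i, …, r; after
  --   moving the run above h down one row the corners above h are T, the
  --   balance records the weight change so far, and h itself may be moved
  --   down next.
  data Outcome : Box → List Box → Set where
    improved : ∀ {h rest} (T : List Box) → length T ≡ length rest → Nested μ (h ∷ T) →
      weight μ rest < weight μ T → Outcome h rest
    pending : ∀ {r c rest} (T : List Box) → length T ≡ length rest → Nested μ ((suc r , c) ∷ T) →
      i ≤ r → c + r ≤ reach μ i → weight μ T + reach μ i ≡ weight μ rest + reach μ r →
      Outcome (r , c) rest

  -- Adding a corner h below a processed part: an improvement is kept; a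
  -- pending run is either closed (h lies more than one row below it), which
  -- yields an improvement, or extended by h (h lies in the next row).
  extend : ∀ {h h₂ rest₂} → InBoard μ h → All (StrictlyNE h) (h₂ ∷ rest₂) → InBoard μ h₂ →
    Outcome h₂ rest₂ → Outcome h (h₂ ∷ rest₂)
  extend {h} {h₂} box (h↗h₂ ∷ _) _ (improved T len (boxes₂T , h₂↗T ∷ nestedT) gain) =
    improved (h₂ ∷ T) (cong suc len)
      (box ∷ boxes₂T , (h↗h₂ ∷ NE-trans-all h↗h₂ h₂↗T) ∷ h₂↗T ∷ nestedT)
      (+-monoʳ-< (Lsize μ h₂) gain)
  extend {rh , ch} {r₂ , c₂} {rest₂} box ((r₂<rh , ch<c₂) ∷ _) box₂
         (pending T len (box₂↓ ∷ boxesT , moved↗T ∷ nestedT) i≤r₂ diagonal balance)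
         with m≤n⇒m<n∨m≡n r₂<rh
  ... | inj₁ gap =
    improved ((suc r₂ , c₂) ∷ T) (cong suc len)
      (box ∷ box₂↓ ∷ boxesT , ((gap , ch<c₂) ∷ NE-trans-all (gap , ch<c₂) moved↗T) ∷ moved↗T ∷ nestedT)
      (shift-improves rest₂ T box₂ box₂↓ i≤r₂ balance)
  ... | inj₂ refl =
    pending ((suc r₂ , c₂) ∷ T) (cong suc len)
      (shift-inBoard i≤rh diagonal′ (proj₁ (proj₂ box)) ∷ box₂↓ ∷ boxesT ,
       ((≤-refl , ch<c₂) ∷ NE-trans-all (≤-refl , ch<c₂) moved↗T) ∷ moved↗T ∷ nestedT)
      i≤rh diagonal′ (weight-shift rest₂ T box₂ box₂↓ balance)
    where
      i≤rh : i ≤ suc r₂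
      i≤rh = m≤n⇒m≤1+n i≤r₂
      diagonal′ : ch + suc r₂ ≤ reach μ i
      diagonal′ = ≤-trans (≤-reflexive (+-suc ch r₂)) (≤-trans (+-monoˡ-≤ r₂ ch<c₂) diagonal)

  -- Process a nested sequence with a corner in row i: that corner starts a
  -- pending run, and the corners below it are then added by `extend`.
  process : ∀ h rest → Nested μ (h ∷ rest) → Any (λ b → proj₁ b ≡ i) (h ∷ rest) → Outcome h rest
  process (r , c) rest (box ∷ boxes , h↗rest ∷ nested) (here refl) =
    pending rest refl (shift-inBoard ≤-refl diagonal (proj₁ (proj₂ box)) ∷ boxes , NE-lower (n≤1+n r) h↗rest ∷ nested)
      ≤-refl diagonal refl
    where
      diagonal : c + r ≤ reach μ r
      diagonal = subst (c + r ≤_) (+-comm (part μ r) r) (+-monoˡ-≤ r (proj₂ (proj₂ box)))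
  process h (h₂ ∷ rest₂) (box ∷ boxes , h↗ ∷ nested) (there found) =
    extend box h↗ (All.head boxes) (process h₂ rest₂ (boxes , nested) found)

  improve : ∀ S → Nested μ S → Any (λ b → proj₁ b ≡ i) S →
    ∃[ T ] (length T ≡ length S × Nested μ T × weight μ S < weight μ T)
  improve ((r , c) ∷ rest) nested found with process (r , c) rest nested found
  ... | improved T len nestedT gain =
    (r , c) ∷ T , cong suc len , nestedT , +-monoʳ-< (Lsize μ (r , c)) gain
  ... | pending T len nestedT i≤r _ balance =
    (suc r , c) ∷ T , cong suc len , nestedT ,
    shift-improves rest T (All.head (proj₁ nested)) (All.head (proj₁ nestedT)) i≤r balance

lemma17 : (μ : List ℕ) → IsPartition μ → (k : ℕ) → 1 ≤ k →
    (w : ℕ) → IsWk μ k w →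
    (S : List Box) → NestedSeq μ k S → weight μ S ≡ w →
    All (λ c → Salient μ (proj₁ c)) S
lemma17 μ P k _ w (_ , maximal) S (length≡k , nested) weight≡w = tabulate corner-salient
  where
    corner-salient : ∀ {b} → b ∈ S → Salient μ (proj₁ b)
    corner-salient {b} b∈S with salient-or-increasing μ (proj₁ b)
    ... | inj₁ salient = salient
    ... | inj₂ increasing
      with Shift.improve μ P (proj₁ b) increasing S nested (Any.map (cong proj₁ ∘ sym) b∈S)
    ... | T , length≡ , nestedT , heavier =
      contradiction (maximal T (trans length≡ length≡k , nestedT))
                    (<⇒≱ (subst (_< weight μ T) weight≡w heavier))
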